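{- The equation $x+y+z=1$ with $x,y,z\in\mathcal{B}^*_2$ and $x\le y\le z$ has infinitely many solutions. Furthermore, the equation $x+y+z=1$ with $x,y,z\in\mathcal{B}_3$ and $x\le y\le z$ has uncountably many solutions, which can be given explicitly.
   Context: Every irrational $x\in(0,1)$ has a simple continued fraction expansion $x=[a_1,a_2,\dots]$ with positive integers $a_k=a_k(x)$. For an integer $B\ge1$, $\mathcal{B}_B$ is the set of irrational $x\in(0,1)$ with $a_k(x)\le B$ for all $k$. For $j\ge0$, $\mathcal{B}_{2,j}$ is the set of irrational $x\in(0,1)$ with $a_k(x)\le 3$ for $k\le j$ and $a_k(x)\le 2$ for $k>j$, and $\mathcal{B}^*_2=\bigcup_{j\ge0}\mathcal{B}_{2,j}$ (the eventually $2$-bad numbers among the $3$-bad numbers). -}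

module Defs where

open import Data.Nat as ℕ using (ℕ; zero; suc)
open import Data.Integer using (+_)
open import Data.Product using (Σ; ∃; _×_; _,_; proj₁; proj₂)
open import Data.Rational.Unnormalised as Q
  using (ℚᵘ; mkℚᵘ; 0ℚᵘ; 1ℚᵘ; ∣_∣)
open import Relation.Binary.PropositionalEquality using (_≢_)
open import Relation.Nullary using (¬_)

-- An infinite simple continued fraction x = [a₁, a₂, …] with all aₖ ≥ 1
-- (i.e. an irrational number in (0,1)) is encoded by c : ℕ → ℕ with
--   a_{k+1} = digit c k = suc (c k).
CF : Set
CF = ℕ → ℕ

digit : CF → ℕ → ℕ
digit c k = suc (c k)

-- Finite continued fraction [a_{i+1}, …, a_{i+n}] as (numerator , denominator - 1).
-- Empty fraction = 0/1; [a, rest] = 1 / (a + rest) = q / (a q + p) when rest = p/q.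
finCF : CF → ℕ → ℕ → ℕ × ℕ
finCF c zero    i = 0 , 0
finCF c (suc n) i with finCF c n (suc i)
... | p , q′ = suc q′ , (q′ ℕ.+ c i ℕ.* suc q′ ℕ.+ p)

conv : CF → ℕ → ℚᵘ
conv c n = mkℚᵘ (+ proj₁ (finCF c n 0)) (proj₂ (finCF c n 0))

Converges : (ℕ → ℚᵘ) → ℚᵘ → Set
Converges s L = ∀ (ε : ℚᵘ) → 0ℚᵘ Q.< ε →
  ∃ λ N → ∀ n → N ℕ.≤ n → ∣ s n Q.- L ∣ Q.< ε

-- equality / order of the real numbers represented (limits of convergents)
_≃ᴿ_ : CF → CF → Set
x ≃ᴿ y = Converges (λ n → conv x n Q.- conv y n) 0ℚᵘ

_≤ᴿ_ : CF → CF → Set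
x ≤ᴿ y = ∀ (ε : ℚᵘ) → 0ℚᵘ Q.< ε →
  ∃ λ N → ∀ n → N ℕ.≤ n → conv x n Q.≤ conv y n Q.+ ε

SumIsOne : CF → CF → CF → Set
SumIsOne x y z = Converges (λ n → conv x n Q.+ conv y n Q.+ conv z n) 1ℚᵘ

Bad : ℕ → CF → Set
Bad B c = ∀ k → digit c k ℕ.≤ B

-- 𝓑_{2,j} : a_k ≤ 3 for k ≤ j, a_k ≤ 2 for k > j  (a_k = digit c (k-1))
Bad2 : ℕ → CF → Set
Bad2 j c = ∀ k → (k ℕ.< j → digit c k ℕ.≤ 3) × (j ℕ.≤ k → digit c k ℕ.≤ 2)

Bad2* : CF → Set
Bad2* c = ∃ λ j → Bad2 j c

Triple : Set
Triple = CF × CF × CF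

_≃³_ : Triple → Triple → Set
(x , y , z) ≃³ (x′ , y′ , z′) = (x ≃ᴿ x′) × (y ≃ᴿ y′) × (z ≃ᴿ z′)

Solution : (CF → Set) → Triple → Set
Solution P (x , y , z) = P x × P y × P z × (x ≤ᴿ y) × (y ≤ᴿ z) × SumIsOne x y z

InfinitelyManySolutions : (CF → Set) → Set
InfinitelyManySolutions P =
  Σ (ℕ → Triple) λ f → (∀ n → Solution P (f n)) ×
    (∀ m n → m ≢ n → ¬ (f m ≃³ f n))

UncountablyManySolutions : (CF → Set) → Set
UncountablyManySolutions P =
  ∀ (f : ℕ → Triple) → ∃ λ t → Solution P t × (∀ n → ¬ (t ≃³ f n))

module Submission where

-- Write x = [3, T], where T concatenates the words 2 and 3112 along a bit sequence s, and let
-- z concatenate the words 2 and 2113 along the same bits. The Möbius map Z(T) = (1 + T)/(3 + T)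
-- intertwines the words: Z∘[2] = [2]∘Z and Z∘[3112] = [2113]∘Z. Hence z = Z(T) while
-- x = 1/(3 + T), so 2x + z = 1 with x ≤ z; all partial quotients are at most 3, and at most 2
-- from some point on when s is eventually 0.
-- After any prefix of x, continuing with the word 2 leaves a tail in [2/5, 1] and continuing
-- with 3112 a tail in [0, 2/7]; the unimodular matrix of the prefix maps these ranges to
-- intervals 4/K apart. So bit sequences with a first difference give different x, and choosing
-- each bit to stay away from the n-th entry of a given enumeration diagonalises out of it.

open import Defs
open import Data.Product using (_×_; _,_; proj₁; proj₂; ∃)
open import Data.Sum using (_⊎_; inj₁; inj₂)
open import Data.Empty using (⊥-elim)
open import Data.Bool using (Bool; true; false; not) renaming (_≟_ to _≟ᵇ_)
open import Data.Bool.Properties using (¬-not; not-involutive)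
open import Data.List as List using ([]; _∷_)
open import Data.List.NonEmpty as List⁺ using (List⁺; _∷_; length)
open import Data.List.Relation.Unary.All using ([]; _∷_)
open import Data.List.NonEmpty.Relation.Unary.All as All⁺ using (_∷_)
open import Relation.Nullary using (¬_; yes; no)
open import Relation.Binary using (tri<; tri≈; tri>)
open import Data.Nat as ℕ using (ℕ; zero; suc; _+_; _*_; _∸_; _≤_; _<_; z≤n; s≤s; z<s)
open import Data.Nat.Properties
open import Relation.Binary.PropositionalEquality
open import Data.Nat.Solver using (module +-*-Solver)
import Data.Integer as ℤ
import Data.Integer.Properties as ℤP
open import Data.Rational.Unnormalised as Q using (ℚᵘ; mkℚᵘ; 0ℚᵘ; 1ℚᵘ; ∣_∣; _≃_; *≤*; *<*; *≡*)
import Data.Rational.Unnormalised.Properties as QP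
import Data.Rational.Unnormalised.Solver as QSolver

-- Continued fractions as Möbius maps

drop : ∀ {A : Set} → ℕ → (ℕ → A) → ℕ → A
drop k s j = s (k + j)

finCF-suc-index : ∀ c n i → finCF c n (suc i) ≡ finCF (drop 1 c) n i
finCF-suc-index c zero i = refl
finCF-suc-index c (suc n) i
  with finCF c n (suc (suc i)) | finCF (drop 1 c) n (suc i) | finCF-suc-index c n (suc i)
... | p , q | .(p , q) | refl = refl

Frac : Set
Frac = ℕ × ℕ

push : ℕ → Frac → Frac
push a (p , q) = q , p + a * q

frac : CF → ℕ → Frac
frac c n = proj₁ (finCF c n 0) , suc (proj₂ (finCF c n 0))

frac-suc : ∀ c n → frac c (suc n) ≡ push (digit c 0) (frac (drop 1 c) n)
frac-suc c n rewrite sym (finCF-suc-index c n 0) with finCF c n 1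
... | p , q = cong (suc q ,_) (trans (cong suc (+-comm (q + c 0 * suc q) p)) (sym (+-suc p _)))

cross : Frac → Frac → ℕ
cross (p , _) (_ , q′) = p * q′

UnitFrac : Frac → Set
UnitFrac (p , q) = p ≤ q × 1 ≤ q

q≤push-den : ∀ a {p q} → q ≤ proj₂ (push (suc a) (p , q))
q≤push-den a {p} {q} = ≤-trans (m≤m+n q (a * q)) (m≤n+m _ p)

push-den-pos : ∀ a {p q} → 1 ≤ q → 1 ≤ proj₂ (push (suc a) (p , q))
push-den-pos a {p} 1≤q = ≤-trans 1≤q (q≤push-den a {p})

push-unit : ∀ a {r} → UnitFrac r → UnitFrac (push (suc a) r)
push-unit a {p , q} (_ , 1≤q) = q≤push-den a {p} , push-den-pos a {p} 1≤q

frac-unit : ∀ c n → UnitFrac (frac c n)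
frac-unit c zero    = z≤n , s≤s z≤n
frac-unit c (suc n) = subst UnitFrac (sym (frac-suc c n)) (push-unit (c 0) (frac-unit (drop 1 c) n))

record Mat : Set where
  constructor mat
  field a b c d : ℕ

act : Mat → Frac → Frac
act (mat a b c d) (p , q) = a * p + b * q , c * p + d * q

idMat : Mat
idMat = mat 1 0 0 1

pushMat : ℕ → Mat → Mat
pushMat k (mat a b c d) = mat c d (a + k * c) (b + k * d)

_⊙_ : Mat → Mat → Mat
mat a b c d ⊙ mat e f g h = mat (a * e + b * g) (a * f + b * h) (c * e + d * g) (c * f + d * h)

act-idMat : ∀ v → act idMat v ≡ v
act-idMat (p , q) = cong₂ _,_ (trans (+-identityʳ (1 * p)) (*-identityˡ p)) (*-identityˡ q)

act-pushMat : ∀ k M v → act (pushMat k M) v ≡ push k (act M v)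
act-pushMat k (mat a b c d) (p , q) = cong (c * p + d * q ,_)
  (solve 7 (λ k a b c d p q → (a :+ k :* c) :* p :+ (b :+ k :* d) :* q
                              := a :* p :+ b :* q :+ k :* (c :* p :+ d :* q)) refl k a b c d p q)
  where open +-*-Solver

act-⊙ : ∀ M N v → act (M ⊙ N) v ≡ act M (act N v)
act-⊙ (mat a b c d) (mat e f g h) (p , q) = cong₂ _,_ (row a b) (row c d)
  where
  open +-*-Solver
  row : ∀ x y → (x * e + y * g) * p + (x * f + y * h) * q ≡ x * (e * p + f * q) + y * (g * p + h * q)
  row x y = solve 8 (λ a b e f g h p q → (a :* e :+ b :* g) :* p :+ (a :* f :+ b :* h) :* q
                                    := a :* (e :* p :+ f :* q) :+ b :* (g :* p :+ h :* q)) refl x y e f g h p q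

prefixMat : CF → ℕ → Mat
prefixMat c zero    = idMat
prefixMat c (suc k) = pushMat (digit c 0) (prefixMat (drop 1 c) k)

act-prefixMat-+ : ∀ c k l v →
  act (prefixMat c (k + l)) v ≡ act (prefixMat c k) (act (prefixMat (drop k c) l) v)
act-prefixMat-+ c zero    l v = sym (act-idMat _)
act-prefixMat-+ c (suc k) l v = begin
  act (pushMat (digit c 0) (prefixMat (drop 1 c) (k + l))) v
    ≡⟨ act-pushMat (digit c 0) (prefixMat (drop 1 c) (k + l)) v ⟩
  push (digit c 0) (act (prefixMat (drop 1 c) (k + l)) v)
    ≡⟨ cong (push (digit c 0)) (act-prefixMat-+ (drop 1 c) k l v) ⟩
  push (digit c 0) (act (prefixMat (drop 1 c) k) (act (prefixMat (drop (suc k) c) l) v))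
    ≡⟨ act-pushMat (digit c 0) (prefixMat (drop 1 c) k) _ ⟨
  act (prefixMat c (suc k)) (act (prefixMat (drop (suc k) c) l) v) ∎
  where open ≡-Reasoning

frac-prefixMat : ∀ c n → frac c n ≡ act (prefixMat c n) (0 , 1)
frac-prefixMat c zero    = refl
frac-prefixMat c (suc n) = begin
  frac c (suc n)                                          ≡⟨ frac-suc c n ⟩
  push (digit c 0) (frac (drop 1 c) n)                    ≡⟨ cong (push (digit c 0)) (frac-prefixMat (drop 1 c) n) ⟩
  push (digit c 0) (act (prefixMat (drop 1 c) n) (0 , 1)) ≡⟨ act-pushMat (digit c 0) (prefixMat (drop 1 c) n) _ ⟨
  act (prefixMat c (suc n)) (0 , 1)                       ∎
  where open ≡-Reasoning

frac-+ : ∀ c k m → frac c (k + m) ≡ act (prefixMat c k) (frac (drop k c) m)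
frac-+ c k m = begin
  frac c (k + m)                                                ≡⟨ frac-prefixMat c (k + m) ⟩
  act (prefixMat c (k + m)) (0 , 1)                             ≡⟨ act-prefixMat-+ c k m _ ⟩
  act (prefixMat c k) (act (prefixMat (drop k c) m) (0 , 1))    ≡⟨ cong (act (prefixMat c k)) (frac-prefixMat (drop k c) m) ⟨
  act (prefixMat c k) (frac (drop k c) m)                       ∎
  where open ≡-Reasoning

prefixMat-agree : ∀ {c c′} k → (∀ j → j < k → c j ≡ c′ j) → prefixMat c k ≡ prefixMat c′ k
prefixMat-agree zero    _ = refl
prefixMat-agree (suc k) h = cong₂ (λ a M → pushMat (suc a) M) (h 0 z<s)
  (prefixMat-agree k (λ j j<k → h (suc j) (s≤s j<k)))

prefixMat-cong : ∀ {c c′} k → (∀ j → c j ≡ c′ j) → prefixMat c k ≡ prefixMat c′ k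
prefixMat-cong k h = prefixMat-agree k (λ j _ → h j)

frac-cong : ∀ {c c′} n → (∀ j → c j ≡ c′ j) → frac c n ≡ frac c′ n
frac-cong {c} {c′} n h = begin
  frac c n                       ≡⟨ frac-prefixMat c n ⟩
  act (prefixMat c n) (0 , 1)    ≡⟨ cong (λ M → act M (0 , 1)) (prefixMat-cong n h) ⟩
  act (prefixMat c′ n) (0 , 1)   ≡⟨ frac-prefixMat c′ n ⟨
  frac c′ n                      ∎
  where open ≡-Reasoning

frac-suc-suc : ∀ c m → frac c (2 + m) ≡ push (digit c 0) (push (digit c 1) (frac (drop 2 c) m))
frac-suc-suc c m = trans (frac-suc c (suc m)) (cong (push (digit c 0)) (frac-suc (drop 1 c) m))

Det⁺ Det⁻ Unimodular : Mat → Set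
Det⁺ (mat a b c d) = a * d ≡ suc (b * c)
Det⁻ (mat a b c d) = b * c ≡ suc (a * d)
Unimodular M = Det⁺ M ⊎ Det⁻ M

pushMat-unimodular : ∀ k M → Unimodular M → Unimodular (pushMat k M)
pushMat-unimodular k (mat a b c d) (inj₁ det⁺) = inj₂ (begin
  d * (a + k * c)          ≡⟨ solve 4 (λ a c d k → d :* (a :+ k :* c) := a :* d :+ k :* c :* d) refl a c d k ⟩
  a * d + k * c * d        ≡⟨ cong (_+ k * c * d) det⁺ ⟩
  suc (b * c + k * c * d)  ≡⟨ cong suc (solve 4 (λ b c d k → b :* c :+ k :* c :* d := c :* (b :+ k :* d)) refl b c d k) ⟩
  suc (c * (b + k * d))    ∎)
  where open ≡-Reasoning; open +-*-Solver
pushMat-unimodular k (mat a b c d) (inj₂ det⁻) = inj₁ (begin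
  c * (b + k * d)          ≡⟨ solve 4 (λ b c d k → c :* (b :+ k :* d) := b :* c :+ k :* c :* d) refl b c d k ⟩
  b * c + k * c * d        ≡⟨ cong (_+ k * c * d) det⁻ ⟩
  suc (a * d + k * c * d)  ≡⟨ cong suc (solve 4 (λ a c d k → a :* d :+ k :* c :* d := d :* (a :+ k :* c)) refl a c d k) ⟩
  suc (d * (a + k * c))    ∎)
  where open ≡-Reasoning; open +-*-Solver

prefixMat-unimodular : ∀ c k → Unimodular (prefixMat c k)
prefixMat-unimodular c zero    = inj₁ refl
prefixMat-unimodular c (suc k) =
  pushMat-unimodular (digit c 0) (prefixMat (drop 1 c) k) (prefixMat-unimodular (drop 1 c) k)

prefixMat-growth : ∀ c k → 1 ≤ Mat.d (prefixMat c k) × suc k ≤ Mat.b (prefixMat c k) + Mat.d (prefixMat c k)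
prefixMat-growth c zero    = s≤s z≤n , s≤s z≤n
prefixMat-growth c (suc k) with prefixMat (drop 1 c) k | prefixMat-growth (drop 1 c) k
... | mat _ b _ d | 1≤d , k<b+d = ≤-trans 1≤d d≤d′ , (begin
  suc (suc k)          ≤⟨ s≤s k<b+d ⟩
  suc (b + d)          ≤⟨ +-monoˡ-≤ (b + d) 1≤d ⟩
  d + (b + d)          ≤⟨ +-monoʳ-≤ d (+-monoʳ-≤ b (m≤m+n d (c 0 * d))) ⟩
  d + (b + digit c 0 * d) ∎)
  where
  open ≤-Reasoning
  d≤d′ : d ≤ b + digit c 0 * d
  d≤d′ = ≤-trans (m≤m+n d (c 0 * d)) (m≤n+m _ b)

prefixMat-den-pos : ∀ c k → 1 ≤ Mat.d (prefixMat c k)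
prefixMat-den-pos c k = proj₁ (prefixMat-growth c k)

prefixMat-den≥ : ∀ c k → k ≤ Mat.d (prefixMat c k)
prefixMat-den≥ c zero    = z≤n
prefixMat-den≥ c (suc k) with prefixMat (drop 1 c) k | prefixMat-growth (drop 1 c) k
... | mat _ b _ d | _ , k<b+d = ≤-trans k<b+d (+-monoʳ-≤ b (m≤m+n d (c 0 * d)))

act-den≥ : ∀ M {p q} → Mat.d M * q ≤ proj₂ (act M (p , q))
act-den≥ (mat _ _ c d) {p} {q} = m≤n+m (d * q) (c * p)

act-den-pos : ∀ M → 1 ≤ Mat.d M → ∀ {r} → UnitFrac r → 1 ≤ proj₂ (act M r)
act-den-pos M 1≤d (_ , 1≤q) = ≤-trans (*-mono-≤ 1≤d 1≤q) (act-den≥ M)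

-- (ad − bc)(p₁q₂ − p₂q₁) = n₁e₂ − n₂e₁ for (nᵢ , eᵢ) = act M (pᵢ , qᵢ), moved so that no subtraction occurs.
det-identity : ∀ a b c d r₁ r₂ → let M = mat a b c d in
  cross (act M r₁) (act M r₂) + (a * d * cross r₂ r₁ + b * c * cross r₁ r₂)
    ≡ cross (act M r₂) (act M r₁) + (a * d * cross r₁ r₂ + b * c * cross r₂ r₁)
det-identity a b c d (p₁ , q₁) (p₂ , q₂) = solve 8 (λ a b c d p₁ q₁ p₂ q₂ →
    (a :* p₁ :+ b :* q₁) :* (c :* p₂ :+ d :* q₂) :+ (a :* d :* (p₂ :* q₁) :+ b :* c :* (p₁ :* q₂))
 := (a :* p₂ :+ b :* q₂) :* (c :* p₁ :+ d :* q₁) :+ (a :* d :* (p₁ :* q₂) :+ b :* c :* (p₂ :* q₁)))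
  refl a b c d p₁ q₁ p₂ q₂
  where open +-*-Solver

private
  cancel-det : ∀ X Y t u v → X + (suc t * u + t * v) ≡ Y + (suc t * v + t * u) → X + u ≡ Y + v
  cancel-det X Y t u v h = +-cancelʳ-≡ (t * u + t * v) (X + u) (Y + v) (begin
    X + u + (t * u + t * v)    ≡⟨ solve 4 (λ X t u v → X :+ u :+ (t :* u :+ t :* v) := X :+ ((con 1 :+ t) :* u :+ t :* v)) refl X t u v ⟩
    X + (suc t * u + t * v)    ≡⟨ h ⟩
    Y + (suc t * v + t * u)    ≡⟨ solve 4 (λ Y t u v → Y :+ ((con 1 :+ t) :* v :+ t :* u) := Y :+ v :+ (t :* u :+ t :* v)) refl Y t u v ⟩
    Y + v + (t * u + t * v)    ∎)
    where open ≡-Reasoning; open +-*-Solver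

cross⁺ : ∀ M → Det⁺ M → ∀ r₁ r₂ →
  cross (act M r₁) (act M r₂) + cross r₂ r₁ ≡ cross (act M r₂) (act M r₁) + cross r₁ r₂
cross⁺ (mat a b c d) det⁺ r₁ r₂ = cancel-det X Y (b * c) (cross r₂ r₁) (cross r₁ r₂)
  (subst (λ ad → X + (ad * cross r₂ r₁ + b * c * cross r₁ r₂) ≡ Y + (ad * cross r₁ r₂ + b * c * cross r₂ r₁))
         det⁺ (det-identity a b c d r₁ r₂))
  where
  X = cross (act (mat a b c d) r₁) (act (mat a b c d) r₂)
  Y = cross (act (mat a b c d) r₂) (act (mat a b c d) r₁)

cross⁻ : ∀ M → Det⁻ M → ∀ r₁ r₂ →
  cross (act M r₁) (act M r₂) + cross r₁ r₂ ≡ cross (act M r₂) (act M r₁) + cross r₂ r₁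
cross⁻ (mat a b c d) det⁻ r₁ r₂ = cancel-det X Y (a * d) (cross r₁ r₂) (cross r₂ r₁)
  (subst (λ bc → X + (bc * cross r₁ r₂ + a * d * cross r₂ r₁) ≡ Y + (bc * cross r₂ r₁ + a * d * cross r₁ r₂))
         det⁻ (trans (cong (X +_) (+-comm (b * c * cross r₁ r₂) (a * d * cross r₂ r₁)))
           (trans (det-identity a b c d r₁ r₂) (cong (Y +_) (+-comm (a * d * cross r₁ r₂) (b * c * cross r₂ r₁))))))
  where
  X = cross (act (mat a b c d) r₁) (act (mat a b c d) r₂)
  Y = cross (act (mat a b c d) r₂) (act (mat a b c d) r₁)

cross-act-≤ : ∀ M → Unimodular M → ∀ {r₁ r₂} → UnitFrac r₁ → UnitFrac r₂ →
  cross (act M r₁) (act M r₂) ≤ cross (act M r₂) (act M r₁) + proj₂ r₁ * proj₂ r₂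
cross-act-≤ M (inj₁ det⁺) {r₁@(p₁ , q₁)} {r₂@(p₂ , q₂)} (p₁≤q₁ , _) _ =
  ≤-trans (m≤m+n _ (p₂ * q₁)) (≤-trans (≤-reflexive (cross⁺ M det⁺ r₁ r₂)) (+-monoʳ-≤ _ (*-monoˡ-≤ q₂ p₁≤q₁)))
cross-act-≤ M (inj₂ det⁻) {r₁@(p₁ , q₁)} {r₂@(p₂ , q₂)} _ (p₂≤q₂ , _) =
  ≤-trans (m≤m+n _ (p₁ * q₂)) (≤-trans (≤-reflexive (cross⁻ M det⁻ r₁ r₂))
    (+-monoʳ-≤ _ (≤-trans (*-monoˡ-≤ q₁ p₂≤q₂) (≤-reflexive (*-comm q₂ q₁)))))

act-margin⁺ : ∀ M → Det⁺ M → ∀ {r₁ r₂ t} → cross r₂ r₁ + t ≤ cross r₁ r₂ →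
  cross (act M r₂) (act M r₁) + t ≤ cross (act M r₁) (act M r₂)
act-margin⁺ M det⁺ {r₁} {r₂} {t} h = +-cancelʳ-≤ (cross r₂ r₁) _ _ (begin
  Y + t + cross r₂ r₁    ≡⟨ +-assoc Y t _ ⟩
  Y + (t + cross r₂ r₁)  ≤⟨ +-monoʳ-≤ Y (≤-trans (≤-reflexive (+-comm t _)) h) ⟩
  Y + cross r₁ r₂        ≡⟨ cross⁺ M det⁺ r₁ r₂ ⟨
  X + cross r₂ r₁        ∎)
  where
  open ≤-Reasoning
  X = cross (act M r₁) (act M r₂)
  Y = cross (act M r₂) (act M r₁)

act-margin⁻ : ∀ M → Det⁻ M → ∀ {r₁ r₂ t} → cross r₂ r₁ + t ≤ cross r₁ r₂ →
  cross (act M r₁) (act M r₂) + t ≤ cross (act M r₂) (act M r₁)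
act-margin⁻ M det⁻ {r₁} {r₂} {t} h = +-cancelʳ-≤ (cross r₂ r₁) _ _ (begin
  X + t + cross r₂ r₁    ≡⟨ +-assoc X t _ ⟩
  X + (t + cross r₂ r₁)  ≤⟨ +-monoʳ-≤ X (≤-trans (≤-reflexive (+-comm t _)) h) ⟩
  X + cross r₁ r₂        ≡⟨ cross⁻ M det⁻ r₁ r₂ ⟩
  Y + cross r₂ r₁        ∎)
  where
  open ≤-Reasoning
  X = cross (act M r₁) (act M r₂)
  Y = cross (act M r₂) (act M r₁)

act-mono⁺ : ∀ M → Det⁺ M → ∀ {r₁ r₂} → cross r₂ r₁ ≤ cross r₁ r₂ →
  cross (act M r₂) (act M r₁) ≤ cross (act M r₁) (act M r₂)
act-mono⁺ M det⁺ {r₁} {r₂} h =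
  ≤-trans (m≤m+n _ 0) (act-margin⁺ M det⁺ {r₁} {r₂} (≤-trans (≤-reflexive (+-identityʳ _)) h))

act-mono⁻ : ∀ M → Det⁻ M → ∀ {r₁ r₂} → cross r₂ r₁ ≤ cross r₁ r₂ →
  cross (act M r₁) (act M r₂) ≤ cross (act M r₂) (act M r₁)
act-mono⁻ M det⁻ {r₁} {r₂} h =
  ≤-trans (m≤m+n _ 0) (act-margin⁻ M det⁻ {r₁} {r₂} (≤-trans (≤-reflexive (+-identityʳ _)) h))

-- conv c n is toℚ (frac c n) by definition; the junk value at denominator 0 never arises.
toℚ : Frac → ℚᵘ
toℚ (p , zero)  = 0ℚᵘ
toℚ (p , suc q) = mkℚᵘ (ℤ.+ p) q

toℚ-≤ : ∀ {r r′} → 1 ≤ proj₂ r → 1 ≤ proj₂ r′ → cross r r′ ≤ cross r′ r → toℚ r Q.≤ toℚ r′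
toℚ-≤ {p , suc q} {p′ , suc q′} _ _ h =
  *≤* (subst₂ ℤ._≤_ (ℤP.pos-* p (suc q′)) (ℤP.pos-* p′ (suc q)) (ℤ.+≤+ h))

toℚ-< : ∀ {r r′} → 1 ≤ proj₂ r → 1 ≤ proj₂ r′ → cross r r′ < cross r′ r → toℚ r Q.< toℚ r′
toℚ-< {p , suc q} {p′ , suc q′} _ _ h =
  *<* (subst₂ ℤ._<_ (ℤP.pos-* p (suc q′)) (ℤP.pos-* p′ (suc q)) (ℤ.+<+ h))

toℚ-≃ : ∀ {r r′} → 1 ≤ proj₂ r → 1 ≤ proj₂ r′ → cross r r′ ≡ cross r′ r → toℚ r ≃ toℚ r′
toℚ-≃ {p , suc q} {p′ , suc q′} _ _ h =
  *≡* (trans (sym (ℤP.pos-* p (suc q′))) (trans (cong ℤ.+_ h) (ℤP.pos-* p′ (suc q))))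

toℚ-+ : ∀ {p q p′ q′} → 1 ≤ q → 1 ≤ q′ → toℚ (p , q) Q.+ toℚ (p′ , q′) ≃ toℚ (p * q′ + p′ * q , q * q′)
toℚ-+ {p} {suc q} {p′} {suc q′} _ _ = QP.≃-reflexive (cong (λ n → mkℚᵘ n (q′ + q * suc q′))
  (trans (cong₂ ℤ._+_ (sym (ℤP.pos-* p (suc q′))) (sym (ℤP.pos-* p′ (suc q)))) (sym (ℤP.pos-+ (p * suc q′) (p′ * suc q)))))

toℚ-≤-+ : ∀ {n e n′ e′ t} → 1 ≤ e → 1 ≤ e′ → n * e′ ≤ n′ * e + t →
  toℚ (n , e) Q.≤ toℚ (n′ , e′) Q.+ toℚ (t , e′ * e)
toℚ-≤-+ {n} {e} {n′} {e′} {t} 1≤e 1≤e′ h =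
  QP.≤-respʳ-≃ (QP.≃-sym (toℚ-+ 1≤e′ 1≤e′e)) (toℚ-≤ 1≤e (*-mono-≤ 1≤e′ 1≤e′e) (begin
    n * (e′ * (e′ * e))          ≡⟨ solve 3 (λ n e e′ → n :* (e′ :* (e′ :* e)) := e′ :* e :* (n :* e′)) refl n e e′ ⟩
    e′ * e * (n * e′)            ≤⟨ *-monoʳ-≤ (e′ * e) h ⟩
    e′ * e * (n′ * e + t)        ≡⟨ solve 4 (λ n′ e e′ t → e′ :* e :* (n′ :* e :+ t) := (n′ :* (e′ :* e) :+ t :* e′) :* e) refl n′ e e′ t ⟩
    (n′ * (e′ * e) + t * e′) * e ∎))
  where
  open ≤-Reasoning; open +-*-Solver
  1≤e′e = *-mono-≤ 1≤e′ 1≤e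

toℚ-+-≤ : ∀ {n e n′ e′ t} → 1 ≤ e → 1 ≤ e′ → n * e′ + t ≤ n′ * e →
  toℚ (n , e) Q.+ toℚ (t , e * e′) Q.≤ toℚ (n′ , e′)
toℚ-+-≤ {n} {e} {n′} {e′} {t} 1≤e 1≤e′ h =
  QP.≤-respˡ-≃ (QP.≃-sym (toℚ-+ 1≤e 1≤ee′)) (toℚ-≤ (*-mono-≤ 1≤e 1≤ee′) 1≤e′ (begin
    (n * (e * e′) + t * e) * e′ ≡⟨ solve 4 (λ n e e′ t → (n :* (e :* e′) :+ t :* e) :* e′ := e :* e′ :* (n :* e′ :+ t)) refl n e e′ t ⟩
    e * e′ * (n * e′ + t)       ≤⟨ *-monoʳ-≤ (e * e′) h ⟩
    e * e′ * (n′ * e)           ≡⟨ solve 3 (λ n′ e e′ → e :* e′ :* (n′ :* e) := n′ :* (e :* (e :* e′))) refl n′ e e′ ⟩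
    n′ * (e * (e * e′))         ∎))
  where
  open ≤-Reasoning; open +-*-Solver
  1≤ee′ = *-mono-≤ 1≤e 1≤e′

toℚ-+-sameDen : ∀ {n n′ e} → 1 ≤ e → toℚ (n , e) Q.+ toℚ (n′ , e) ≃ toℚ (n + n′ , e)
toℚ-+-sameDen {n} {n′} {e} 1≤e = QP.≃-trans (toℚ-+ 1≤e 1≤e) (toℚ-≃ (*-mono-≤ 1≤e 1≤e) 1≤e
  (solve 3 (λ n n′ e → (n :* e :+ n′ :* e) :* e := (n :+ n′) :* (e :* e)) refl n n′ e))
  where open +-*-Solver

toℚ-4≃ : ∀ {K} → 1 ≤ K → toℚ (4 , K) ≃ (toℚ (1 , K) Q.+ toℚ (1 , K)) Q.+ (toℚ (1 , K) Q.+ toℚ (1 , K))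
toℚ-4≃ 1≤K = QP.≃-sym (QP.≃-trans (QP.+-cong (toℚ-+-sameDen 1≤K) (toℚ-+-sameDen 1≤K)) (toℚ-+-sameDen 1≤K))

0<toℚ-1 : ∀ {K} → 1 ≤ K → 0ℚᵘ Q.< toℚ (1 , K)
0<toℚ-1 1≤K = toℚ-< {0 , 1} (s≤s z≤n) 1≤K (s≤s z≤n)

toℚ-1/-antimono : ∀ {a b} → 1 ≤ a → a ≤ b → toℚ (1 , b) Q.≤ toℚ (1 , a)
toℚ-1/-antimono {a} {b} 1≤a a≤b = toℚ-≤ (≤-trans 1≤a a≤b) 1≤a (*-monoʳ-≤ 1 a≤b)

n≤n*n : ∀ {n} → 1 ≤ n → n ≤ n * n
n≤n*n {n} 1≤n = m≤m*n n n {{ℕ.>-nonZero 1≤n}}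

p≤∣p∣ : ∀ p → p Q.≤ ∣ p ∣
p≤∣p∣ p@(mkℚᵘ (ℤ.+ _) _)    = QP.≤-refl
p≤∣p∣ p@(mkℚᵘ ℤ.-[1+ _ ] _) = QP.≤-trans (QP.<⇒≤ (QP.negative⁻¹ p)) (QP.0≤∣p∣ p)

∣p-q∣≃∣q-p∣ : ∀ p q → ∣ p Q.- q ∣ ≃ ∣ q Q.- p ∣
∣p-q∣≃∣q-p∣ p q = QP.≃-trans (QP.∣-∣-cong (solve 2 (λ p q → p :- q := :- (q :- p)) QP.≃-refl p q))
                              (QP.∣-p∣≃∣p∣ (q Q.- p))
  where open QSolver.+-*-Solver

q+r≤p⇒r≤∣p-q∣ : ∀ {p q r} → q Q.+ r Q.≤ p → r Q.≤ ∣ p Q.- q ∣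
q+r≤p⇒r≤∣p-q∣ {p} {q} {r} h = QP.≤-trans
  (QP.≤-respˡ-≃ (solve 2 (λ q r → (q :+ r) :- q := r) QP.≃-refl q r) (QP.+-monoˡ-≤ (Q.- q) h))
  (p≤∣p∣ (p Q.- q))
  where open QSolver.+-*-Solver

p+p≤q+q⇒p≤q : ∀ {p q} → p Q.+ p Q.≤ q Q.+ q → p Q.≤ q
p+p≤q+q⇒p≤q {p} {q} h with p QP.≤? q
... | yes p≤q = p≤q
... | no  p≰q = ⊥-elim (QP.<⇒≱ (QP.+-mono-< (QP.≰⇒> p≰q) (QP.≰⇒> p≰q)) h)

p+r≤q+r⇒p≤q : ∀ {p q r} → p Q.+ r Q.≤ q Q.+ r → p Q.≤ q
p+r≤q+r⇒p≤q {p} {q} {r} h with p QP.≤? q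
... | yes p≤q = p≤q
... | no  p≰q = ⊥-elim (QP.<⇒≱ (QP.+-monoˡ-< r (QP.≰⇒> p≰q)) h)

p≤q+r⇒p-q≤r : ∀ {p q r} → p Q.≤ q Q.+ r → p Q.- q Q.≤ r
p≤q+r⇒p-q≤r {p} {q} {r} h =
  QP.≤-respʳ-≃ (solve 2 (λ q r → (q :+ r) :- q := r) QP.≃-refl q r) (QP.+-monoˡ-≤ (Q.- q) h)
  where open QSolver.+-*-Solver

∣p-q∣≤r : ∀ {p q r} → p Q.≤ q Q.+ r → q Q.≤ p Q.+ r → ∣ p Q.- q ∣ Q.≤ r
∣p-q∣≤r {p} {q} {r} p≤q+r q≤p+r with QP.∣p∣≡p∨∣p∣≡-p (p Q.- q)
... | inj₁ ∣p-q∣≡p-q  = subst (Q._≤ r) (sym ∣p-q∣≡p-q) (p≤q+r⇒p-q≤r p≤q+r)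
... | inj₂ ∣p-q∣≡q-p = subst (Q._≤ r) (sym ∣p-q∣≡q-p)
  (QP.≤-respˡ-≃ (solve 2 (λ p q → q :- p := :- (p :- q)) QP.≃-refl p q) (p≤q+r⇒p-q≤r q≤p+r))
  where open QSolver.+-*-Solver

ε+ε≤∣p-q∣⇒ε≤∣p-r∣ : ∀ {p q r ε} → ε Q.+ ε Q.≤ ∣ p Q.- q ∣ → ∣ q Q.- r ∣ Q.≤ ε → ε Q.≤ ∣ p Q.- r ∣
ε+ε≤∣p-q∣⇒ε≤∣p-r∣ {p} {q} {r} {ε} 2ε≤∣p-q∣ ∣q-r∣≤ε = p+r≤q+r⇒p≤q (begin
  ε Q.+ ε                           ≤⟨ 2ε≤∣p-q∣ ⟩
  ∣ p Q.- q ∣                       ≃⟨ QP.∣-∣-cong (solve 3 (λ p q r → p :- q := (p :- r) :+ (r :- q)) QP.≃-refl p q r) ⟩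
  ∣ (p Q.- r) Q.+ (r Q.- q) ∣       ≤⟨ QP.∣p+q∣≤∣p∣+∣q∣ (p Q.- r) (r Q.- q) ⟩
  ∣ p Q.- r ∣ Q.+ ∣ r Q.- q ∣       ≤⟨ QP.+-monoʳ-≤ ∣ p Q.- r ∣ (QP.≤-respˡ-≃ (∣p-q∣≃∣q-p∣ q r) ∣q-r∣≤ε) ⟩
  ∣ p Q.- r ∣ Q.+ ε                 ∎)
  where open QP.≤-Reasoning; open QSolver.+-*-Solver

-- Contraction and separation

act-dist : ∀ M → Unimodular M → 1 ≤ Mat.d M → ∀ {r₁ r₂} → UnitFrac r₁ → UnitFrac r₂ →
  ∣ toℚ (act M r₁) Q.- toℚ (act M r₂) ∣ Q.≤ toℚ (1 , Mat.d M * Mat.d M)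
act-dist M unimod 1≤d u₁ u₂ = ∣p-q∣≤r (close u₁ u₂) (close u₂ u₁)
  where
  d = Mat.d M
  1≤dd = *-mono-≤ 1≤d 1≤d
  close : ∀ {r₁ r₂} → UnitFrac r₁ → UnitFrac r₂ → toℚ (act M r₁) Q.≤ toℚ (act M r₂) Q.+ toℚ (1 , d * d)
  close {r₁@(p₁ , q₁)} {r₂@(p₂ , q₂)} u₁ u₂ = QP.≤-trans
    (toℚ-≤-+ (act-den-pos M 1≤d u₁) (act-den-pos M 1≤d u₂) (cross-act-≤ M unimod u₁ u₂))
    (QP.+-monoʳ-≤ (toℚ (act M r₂)) (toℚ-≤ (*-mono-≤ (act-den-pos M 1≤d u₂) (act-den-pos M 1≤d u₁)) 1≤dd (begin
      q₁ * q₂ * (d * d)                      ≡⟨ solve 3 (λ q₁ q₂ d → q₁ :* q₂ :* (d :* d) := (d :* q₂) :* (d :* q₁)) refl q₁ q₂ d ⟩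
      (d * q₂) * (d * q₁)                    ≤⟨ *-mono-≤ (act-den≥ M) (act-den≥ M) ⟩
      proj₂ (act M r₂) * proj₂ (act M r₁)    ≡⟨ *-identityˡ _ ⟨
      1 * (proj₂ (act M r₂) * proj₂ (act M r₁)) ∎)))
    where open ≤-Reasoning; open +-*-Solver

-- Bit false selects the fractions in [2/5, 1], bit true those in [0, 2/7].
InRange : Bool → Frac → Set
InRange false r = cross (2 , 5) r ≤ cross r (2 , 5)
InRange true  r = cross r (2 , 7) ≤ cross (2 , 7) r

2/5-unit : UnitFrac (2 , 5)
2/5-unit = s≤s (s≤s z≤n) , s≤s z≤n

2/7-unit : UnitFrac (2 , 7)
2/7-unit = s≤s (s≤s z≤n) , s≤s z≤n

push-push-inRange-false : ∀ a {r} → 1 ≤ a → UnitFrac r → InRange false (push 2 (push (suc a) r))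
push-push-inRange-false a {p , q} 1≤a _ = begin
  2 * (q + 2 * P)   ≡⟨ solve 2 (λ q P → con 2 :* (q :+ con 2 :* P) := con 2 :* q :+ con 4 :* P) refl q P ⟩
  2 * q + 4 * P     ≤⟨ +-monoˡ-≤ (4 * P) (≤-trans (*-monoˡ-≤ q (s≤s 1≤a)) (m≤n+m (suc a * q) p)) ⟩
  P + 4 * P         ≡⟨ solve 1 (λ P → P :+ con 4 :* P := P :* con 5) refl P ⟩
  P * 5             ∎
  where
  open ≤-Reasoning; open +-*-Solver
  P = p + suc a * q

push-push-inRange-true : ∀ {r} → UnitFrac r → InRange true (push 3 (push 1 r))
push-push-inRange-true {p , q} (p≤q , _) = begin
  P * 7             ≡⟨ solve 1 (λ P → P :* con 7 := P :+ con 6 :* P) refl P ⟩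
  P + 6 * P         ≤⟨ +-monoˡ-≤ (6 * P) (+-monoˡ-≤ (1 * q) p≤q) ⟩
  q + 1 * q + 6 * P ≡⟨ solve 2 (λ q P → q :+ con 1 :* q :+ con 6 :* P := con 2 :* (q :+ con 3 :* P)) refl q P ⟩
  2 * (q + 3 * P)   ∎
  where
  open ≤-Reasoning; open +-*-Solver
  P = p + 1 * q

record Separation (M : Mat) : Set where
  field
    lowBit      : Bool
    K           : ℕ
    1≤K         : 1 ≤ K
    lower upper : ℚᵘ

  δ : ℚᵘ
  δ = toℚ (1 , K)

  field
    gap   : lower Q.+ ((δ Q.+ δ) Q.+ (δ Q.+ δ)) Q.≤ upper
    below : ∀ {r} → UnitFrac r → InRange lowBit r → toℚ (act M r) Q.≤ lower
    above : ∀ {r} → UnitFrac r → InRange (not lowBit) r → upper Q.≤ toℚ (act M r)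

separation : ∀ M → Unimodular M → 1 ≤ Mat.d M → Separation M
separation M@(mat a b c d) (inj₁ det⁺) 1≤d = record
  { lowBit = true
  ; K      = e₇ * e₅
  ; 1≤K    = *-mono-≤ 1≤e₇ 1≤e₅
  ; lower  = toℚ (act M (2 , 7))
  ; upper  = toℚ (act M (2 , 5))
  ; gap    = QP.≤-respˡ-≃ (QP.+-congʳ (toℚ (act M (2 , 7))) (toℚ-4≃ (*-mono-≤ 1≤e₇ 1≤e₅)))
               (toℚ-+-≤ 1≤e₇ 1≤e₅ (act-margin⁺ M det⁺ {2 , 5} {2 , 7} {4} ≤-refl))
  ; below  = λ {r} u r≤2/7 → toℚ-≤ (act-den-pos M 1≤d u) 1≤e₇ (act-mono⁺ M det⁺ {2 , 7} {r} r≤2/7)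
  ; above  = λ {r} u 2/5≤r → toℚ-≤ 1≤e₅ (act-den-pos M 1≤d u) (act-mono⁺ M det⁺ {r} {2 , 5} 2/5≤r)
  }
  where
  e₅ = proj₂ (act M (2 , 5))
  e₇ = proj₂ (act M (2 , 7))
  1≤e₅ = act-den-pos M 1≤d 2/5-unit
  1≤e₇ = act-den-pos M 1≤d 2/7-unit
separation M@(mat a b c d) (inj₂ det⁻) 1≤d = record
  { lowBit = false
  ; K      = e₅ * e₇
  ; 1≤K    = *-mono-≤ 1≤e₅ 1≤e₇
  ; lower  = toℚ (act M (2 , 5))
  ; upper  = toℚ (act M (2 , 7))
  ; gap    = QP.≤-respˡ-≃ (QP.+-congʳ (toℚ (act M (2 , 5))) (toℚ-4≃ (*-mono-≤ 1≤e₅ 1≤e₇)))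
               (toℚ-+-≤ 1≤e₅ 1≤e₇ (act-margin⁻ M det⁻ {2 , 5} {2 , 7} {4} ≤-refl))
  ; below  = λ {r} u 2/5≤r → toℚ-≤ (act-den-pos M 1≤d u) 1≤e₅ (act-mono⁻ M det⁻ {r} {2 , 5} 2/5≤r)
  ; above  = λ {r} u r≤2/7 → toℚ-≤ 1≤e₇ (act-den-pos M 1≤d u) (act-mono⁻ M det⁻ {2 , 7} {r} r≤2/7)
  }
  where
  e₅ = proj₂ (act M (2 , 5))
  e₇ = proj₂ (act M (2 , 7))
  1≤e₅ = act-den-pos M 1≤d 2/5-unit
  1≤e₇ = act-den-pos M 1≤d 2/7-unit

above-midpoint-far : ∀ {x A lower upper ε} → upper Q.≤ x → A Q.+ A Q.≤ lower Q.+ upper →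
  lower Q.+ (ε Q.+ ε) Q.≤ upper → ε Q.≤ ∣ x Q.- A ∣
above-midpoint-far {x} {A} {lower} {upper} {ε} upper≤x A+A≤ gap = q+r≤p⇒r≤∣p-q∣ {x} {A} (p+p≤q+q⇒p≤q {A Q.+ ε} {x} (begin
  (A Q.+ ε) Q.+ (A Q.+ ε)        ≃⟨ solve 2 (λ A ε → (A :+ ε) :+ (A :+ ε) := (A :+ A) :+ (ε :+ ε)) QP.≃-refl A ε ⟩
  (A Q.+ A) Q.+ (ε Q.+ ε)        ≤⟨ QP.+-monoˡ-≤ (ε Q.+ ε) A+A≤ ⟩
  (lower Q.+ upper) Q.+ (ε Q.+ ε) ≃⟨ solve 3 (λ l u ε → (l :+ u) :+ (ε :+ ε) := (l :+ (ε :+ ε)) :+ u) QP.≃-refl lower upper ε ⟩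
  (lower Q.+ (ε Q.+ ε)) Q.+ upper ≤⟨ QP.+-mono-≤ (QP.≤-trans gap upper≤x) upper≤x ⟩
  x Q.+ x                        ∎))
  where open QP.≤-Reasoning; open QSolver.+-*-Solver

below-midpoint-far : ∀ {x A lower upper ε} → x Q.≤ lower → lower Q.+ upper Q.≤ A Q.+ A →
  lower Q.+ (ε Q.+ ε) Q.≤ upper → ε Q.≤ ∣ x Q.- A ∣
below-midpoint-far {x} {A} {lower} {upper} {ε} x≤lower ≤A+A gap =
  QP.≤-respʳ-≃ (∣p-q∣≃∣q-p∣ A x) (q+r≤p⇒r≤∣p-q∣ {A} {x} (p+p≤q+q⇒p≤q {x Q.+ ε} {A} (begin
  (x Q.+ ε) Q.+ (x Q.+ ε)         ≤⟨ QP.+-mono-≤ (QP.+-monoˡ-≤ ε x≤lower) (QP.+-monoˡ-≤ ε x≤lower) ⟩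
  (lower Q.+ ε) Q.+ (lower Q.+ ε) ≃⟨ solve 2 (λ l ε → (l :+ ε) :+ (l :+ ε) := l :+ (l :+ (ε :+ ε))) QP.≃-refl lower ε ⟩
  lower Q.+ (lower Q.+ (ε Q.+ ε)) ≤⟨ QP.+-monoʳ-≤ lower gap ⟩
  lower Q.+ upper                 ≤⟨ ≤A+A ⟩
  A Q.+ A                         ∎)))
  where open QP.≤-Reasoning; open QSolver.+-*-Solver

module _ {M : Mat} (S : Separation M) where
  open Separation S

  choose : ℚᵘ → Bool
  choose A with A Q.+ A QP.≤? lower Q.+ upper
  ... | yes _ = not lowBit
  ... | no  _ = lowBit

  choose-far : ∀ A {r} → UnitFrac r → InRange (choose A) r → δ Q.+ δ Q.≤ ∣ toℚ (act M r) Q.- A ∣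
  choose-far A u inRange with A Q.+ A QP.≤? lower Q.+ upper
  ... | yes A+A≤ = above-midpoint-far {lower = lower} (above u inRange) A+A≤ gap
  ... | no  A+A≰ = below-midpoint-far {lower = lower} (below u inRange) (QP.<⇒≤ (QP.≰⇒> A+A≰)) gap

  0≤δ+δ : 0ℚᵘ Q.≤ δ Q.+ δ
  0≤δ+δ = QP.+-mono-≤ (QP.<⇒≤ (0<toℚ-1 1≤K)) (QP.<⇒≤ (0<toℚ-1 1≤K))

  lower-upper-far : ∀ {x x′} → x Q.≤ lower → upper Q.≤ x′ → δ Q.+ δ Q.≤ ∣ x′ Q.- x ∣
  lower-upper-far {x} {x′} x≤lower upper≤x′ = q+r≤p⇒r≤∣p-q∣ {x′} {x} (begin
    x Q.+ (δ Q.+ δ)                      ≤⟨ QP.+-monoˡ-≤ (δ Q.+ δ) x≤lower ⟩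
    lower Q.+ (δ Q.+ δ)                  ≤⟨ QP.p≤p+q (lower Q.+ (δ Q.+ δ)) (δ Q.+ δ) {{Q.nonNegative 0≤δ+δ}} ⟩
    lower Q.+ (δ Q.+ δ) Q.+ (δ Q.+ δ)    ≃⟨ QP.+-assoc lower (δ Q.+ δ) (δ Q.+ δ) ⟩
    lower Q.+ ((δ Q.+ δ) Q.+ (δ Q.+ δ))  ≤⟨ gap ⟩
    upper                                ≤⟨ upper≤x′ ⟩
    x′                                   ∎)
    where open QP.≤-Reasoning

  separated : ∀ b {r r′} → UnitFrac r → UnitFrac r′ → InRange b r → InRange (not b) r′ →
    δ Q.+ δ Q.≤ ∣ toℚ (act M r) Q.- toℚ (act M r′) ∣
  separated b {r} {r′} u u′ inRange inRange′ with b ≟ᵇ lowBit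
  ... | yes refl = QP.≤-respʳ-≃ (∣p-q∣≃∣q-p∣ (toℚ (act M r′)) (toℚ (act M r)))
                     (lower-upper-far (below u inRange) (above u′ inRange′))
  ... | no  b≢lowBit = lower-upper-far
    (below u′ (subst (λ b′ → InRange b′ _) (trans (cong not (¬-not b≢lowBit)) (not-involutive lowBit)) inRange′))
    (above u (subst (λ b′ → InRange b′ _) (¬-not b≢lowBit) inRange))

converges-if : ∀ {u L} → (∀ k → ∃ λ N → ∀ n → N ≤ n → ∣ u n Q.- L ∣ Q.≤ toℚ (1 , suc k)) → Converges u L
converges-if h (mkℚᵘ (ℤ.+ zero)  _) (*<* (ℤ.+<+ ()))
converges-if h (mkℚᵘ ℤ.-[1+ _ ] _) (*<* ())
converges-if h (mkℚᵘ (ℤ.+ suc e) d) _ = N , λ n N≤n → QP.≤-<-trans (bound n N≤n)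
  (toℚ-< (s≤s z≤n) (s≤s z≤n) (begin-strict
    1 * suc d       ≡⟨ *-identityˡ (suc d) ⟩
    suc d           <⟨ n<1+n (suc d) ⟩
    suc (suc d)     ≤⟨ m≤m+n (suc (suc d)) (e * suc (suc d)) ⟩
    suc e * suc (suc d) ∎))
  where
  open ≤-Reasoning
  N = proj₁ (h (suc d))
  bound = proj₂ (h (suc d))

≤ᴿ-if-pointwise : ∀ {x y} → (∀ n → conv x n Q.≤ conv y n) → x ≤ᴿ y
≤ᴿ-if-pointwise {x} {y} h ε 0<ε = 0 , λ n _ → QP.≤-trans (h n) (QP.p≤p+q (conv y n) ε {{Q.nonNegative (QP.<⇒≤ 0<ε)}})

conv-cauchy : ∀ c {K N} → 1 ≤ K → K ≤ N → ∣ conv c K Q.- conv c N ∣ Q.≤ toℚ (1 , K)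
conv-cauchy c {K} {N} 1≤K K≤N = QP.≤-trans
  (subst₂ (λ u v → ∣ toℚ u Q.- toℚ v ∣ Q.≤ toℚ (1 , D * D)) (sym (frac-prefixMat c K)) (sym cN≡)
    (act-dist P (prefixMat-unimodular c K) 1≤D (z≤n , s≤s z≤n) (frac-unit (drop K c) (N ∸ K))))
  (toℚ-1/-antimono 1≤K (≤-trans (prefixMat-den≥ c K) (n≤n*n 1≤D)))
  where
  P = prefixMat c K
  D = Mat.d P
  1≤D = prefixMat-den-pos c K
  cN≡ : frac c N ≡ act P (frac (drop K c) (N ∸ K))
  cN≡ = trans (cong (frac c) (sym (m+[n∸m]≡n K≤N))) (frac-+ c K (N ∸ K))

≄ᴿ-if-apart : ∀ {x y δ} → 0ℚᵘ Q.< δ → (∀ N₀ → ∃ λ N → N₀ ≤ N × δ Q.≤ ∣ conv x N Q.- conv y N ∣) → ¬ (x ≃ᴿ y)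
≄ᴿ-if-apart {x} {y} {δ} 0<δ apart x≃y with x≃y δ 0<δ
... | N₀ , close with apart N₀
...   | N , N₀≤N , δ≤ = QP.<⇒≱ (close N N₀≤N)
  (QP.≤-respʳ-≃ (QP.∣-∣-cong (QP.≃-sym (QP.+-identityʳ (conv x N Q.- conv y N)))) δ≤)

-- Block substitutions

Block : Set
Block = List⁺ ℕ

-- The word w followed by the blocks β (s 0), β (s 1), …
spell : (Bool → Block) → Block → (ℕ → Bool) → CF
spell β (d ∷ _)      s zero    = d
spell β (_ ∷ [])     s (suc k) = spell β (β (s 0)) (drop 1 s) k
spell β (_ ∷ e ∷ es) s (suc k) = spell β (e ∷ es) s k

substitute : (Bool → Block) → (ℕ → Bool) → CF
substitute β s = spell β (β (s 0)) (drop 1 s)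

offset : (Bool → Block) → (ℕ → Bool) → ℕ → ℕ
offset β s zero    = 0
offset β s (suc m) = length (β (s 0)) + offset β (drop 1 s) m

spell-drop : ∀ β w s k → spell β w s (length w + k) ≡ substitute β s k
spell-drop β (d ∷ ds) s k = go d ds
  where
  go : ∀ d ds → spell β (d ∷ ds) s (length (d ∷ ds) + k) ≡ substitute β s k
  go d []       = refl
  go d (e ∷ es) = go e es

substitute-drop : ∀ β s m k → substitute β s (offset β s m + k) ≡ substitute β (drop m s) k
substitute-drop β s zero    k = refl
substitute-drop β s (suc m) k = begin
  substitute β s (length w + l + k)      ≡⟨ cong (substitute β s) (+-assoc (length w) l k) ⟩
  spell β w (drop 1 s) (length w + (l + k)) ≡⟨ spell-drop β w (drop 1 s) (l + k) ⟩
  substitute β (drop 1 s) (l + k)        ≡⟨ substitute-drop β (drop 1 s) m k ⟩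
  substitute β (drop (suc m) s) k        ∎
  where
  open ≡-Reasoning
  w = β (s 0)
  l = offset β (drop 1 s) m

m≤offset : ∀ β s m → m ≤ offset β s m
m≤offset β s zero    = z≤n
m≤offset β s (suc m) =
  s≤s (≤-trans (m≤offset β (drop 1 s) m) (m≤n+m _ (List.length (List⁺.tail (β (s 0))))))

offset-cong : ∀ {β β′} → (∀ b → length (β b) ≡ length (β′ b)) → ∀ s m → offset β s m ≡ offset β′ s m
offset-cong eq s zero    = refl
offset-cong eq s (suc m) = cong₂ _+_ (eq (s 0)) (offset-cong eq (drop 1 s) m)

spell-≤ : ∀ {B} β w s → All⁺.All (_≤ B) w → (∀ j → All⁺.All (_≤ B) (β (s j))) → ∀ k → spell β w s k ≤ B
spell-≤ β (d ∷ _)      s (d≤B ∷ _)        hβ zero    = d≤B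
spell-≤ β (_ ∷ [])     s _                hβ (suc k) = spell-≤ β (β (s 0)) (drop 1 s) (hβ 0) (λ j → hβ (suc j)) k
spell-≤ β (_ ∷ e ∷ es) s (_ ∷ (e≤B ∷ es≤B)) hβ (suc k) = spell-≤ β (e ∷ es) s (e≤B ∷ es≤B) hβ k

substitute-≤ : ∀ {B} β s → (∀ j → All⁺.All (_≤ B) (β (s j))) → ∀ k → substitute β s k ≤ B
substitute-≤ β s hβ = spell-≤ β (β (s 0)) (drop 1 s) (hβ 0) (λ j → hβ (suc j))

spell-agree : ∀ β w {s s′ l} → (∀ k → k < l → substitute β s k ≡ substitute β s′ k) →
  ∀ k → k < length w + l → spell β w s k ≡ spell β w s′ k
spell-agree β (_ ∷ _)      h zero    _         = refl
spell-agree β (_ ∷ [])     h (suc k) (s≤s k<l) = h k k<l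
spell-agree β (_ ∷ e ∷ es) h (suc k) (s≤s k<l) = spell-agree β (e ∷ es) h k k<l

substitute-agree : ∀ β n {s s′} → (∀ j → j < n → s j ≡ s′ j) →
  offset β s n ≡ offset β s′ n × (∀ k → k < offset β s n → substitute β s k ≡ substitute β s′ k)
substitute-agree β zero    h = refl , λ _ ()
substitute-agree β (suc n) {s} {s′} h =
  cong₂ _+_ (cong (λ b → length (β b)) s₀≡s′₀) (proj₁ tails) ,
  λ k k<l → trans (spell-agree β (β (s 0)) (proj₂ tails) k k<l)
                  (cong (λ b → spell β (β b) (drop 1 s′) k) s₀≡s′₀)
  where
  s₀≡s′₀ = h 0 z<s
  tails = substitute-agree β n (λ j j<n → h (suc j) (s≤s j<n))

substitute-≤-eventually : ∀ {B} β s n → (∀ j → n ≤ j → s j ≡ false) → All⁺.All (_≤ B) (β false) →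
  ∀ k → offset β s n ≤ k → substitute β s k ≤ B
substitute-≤-eventually {B} β s n eventually-false β-false≤B k L≤k =
  subst (_≤ B) tail≡ (substitute-≤ β (drop n s) tail-blocks≤B (k ∸ L))
  where
  L = offset β s n
  tail-blocks≤B : ∀ j → All⁺.All (_≤ B) (β (drop n s j))
  tail-blocks≤B j = subst (λ b → All⁺.All (_≤ B) (β b)) (sym (eventually-false (n + j) (m≤m+n n j))) β-false≤B
  tail≡ : substitute β (drop n s) (k ∸ L) ≡ substitute β s k
  tail≡ = trans (sym (substitute-drop β s n (k ∸ L))) (cong (substitute β s) (m+[n∸m]≡n L≤k))

frac-substitute : ∀ β s m n → offset β s m ≤ n →
  frac (substitute β s) n
    ≡ act (prefixMat (substitute β s) (offset β s m)) (frac (substitute β (drop m s)) (n ∸ offset β s m))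
frac-substitute β s m n L≤n = begin
  frac (substitute β s) n                    ≡⟨ cong (frac (substitute β s)) (m+[n∸m]≡n L≤n) ⟨
  frac (substitute β s) (L + (n ∸ L))        ≡⟨ frac-+ (substitute β s) L (n ∸ L) ⟩
  act (prefixMat (substitute β s) L) (frac (drop L (substitute β s)) (n ∸ L))
    ≡⟨ cong (act (prefixMat (substitute β s) L)) (frac-cong (n ∸ L) (substitute-drop β s m)) ⟩
  act (prefixMat (substitute β s) L) (frac (substitute β (drop m s)) (n ∸ L)) ∎
  where
  open ≡-Reasoning
  L = offset β s m

act-prefixMat-substitute : ∀ β s m v →
  act (prefixMat (substitute β s) (offset β s (suc m))) v
    ≡ act (prefixMat (substitute β s) (length (β (s 0))))
          (act (prefixMat (substitute β (drop 1 s)) (offset β (drop 1 s) m)) v)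
act-prefixMat-substitute β s m v = trans (act-prefixMat-+ (substitute β s) (length w) _ v)
  (cong (λ M → act (prefixMat (substitute β s) (length w)) (act M v))
        (prefixMat-cong (offset β (drop 1 s) m) (spell-drop β w (drop 1 s))))
  where w = β (s 0)

-- The solutions (x, x, z)

-- Entries are partial quotients minus one: t is built from the words 2 and 3112, z from 2 and 2113.
tBlock zBlock : Bool → Block
tBlock false = 1 ∷ []
tBlock true  = 2 ∷ 0 ∷ 0 ∷ 1 ∷ []
zBlock false = 1 ∷ []
zBlock true  = 1 ∷ 0 ∷ 0 ∷ 2 ∷ []

tCF zCF xCF : (ℕ → Bool) → CF
tCF = substitute tBlock
zCF = substitute zBlock
xCF = spell tBlock (2 ∷ [])

zBlock-head : ∀ b → List⁺.head (zBlock b) ≡ 1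
zBlock-head false = refl
zBlock-head true  = refl

tBlock-head≥1 : ∀ b → 1 ≤ List⁺.head (tBlock b)
tBlock-head≥1 false = ≤-refl
tBlock-head≥1 true  = s≤s z≤n

tBlock-≤2 : ∀ b → All⁺.All (_≤ 2) (tBlock b)
tBlock-≤2 false = s≤s z≤n ∷ []
tBlock-≤2 true  = ≤-refl ∷ z≤n ∷ z≤n ∷ s≤s z≤n ∷ []

zBlock-≤2 : ∀ b → All⁺.All (_≤ 2) (zBlock b)
zBlock-≤2 false = s≤s z≤n ∷ []
zBlock-≤2 true  = s≤s z≤n ∷ z≤n ∷ z≤n ∷ ≤-refl ∷ []

xCF-≤2 : ∀ s k → xCF s k ≤ 2
xCF-≤2 s = spell-≤ tBlock (2 ∷ []) s (≤-refl ∷ []) (λ j → tBlock-≤2 (s j))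

zCF-≤2 : ∀ s k → zCF s k ≤ 2
zCF-≤2 s = substitute-≤ zBlock s (λ j → zBlock-≤2 (s j))

Zmat : Mat
Zmat = mat 1 1 1 3

Zmat-intertwines-block : ∀ b s s′ v →
  act Zmat (act (prefixMat (spell tBlock (tBlock b) s) (length (tBlock b))) v)
    ≡ act (prefixMat (spell zBlock (zBlock b) s′) (length (zBlock b))) (act Zmat v)
Zmat-intertwines-block b s s′ v =
  trans (sym (act-⊙ Zmat (wordMat tBlock s b) v)) (trans (cong (λ M → act M v) (commute b)) (act-⊙ (wordMat zBlock s′ b) Zmat v))
  where
  wordMat : (Bool → Block) → (ℕ → Bool) → Bool → Mat
  wordMat β s b = prefixMat (spell β (β b) s) (length (β b))
  commute : ∀ b → Zmat ⊙ wordMat tBlock s b ≡ wordMat zBlock s′ b ⊙ Zmat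
  commute false = refl
  commute true  = refl

Zmat-intertwines : ∀ s m v →
  act Zmat (act (prefixMat (tCF s) (offset tBlock s m)) v)
    ≡ act (prefixMat (zCF s) (offset zBlock s m)) (act Zmat v)
Zmat-intertwines s zero    v = trans (cong (act Zmat) (act-idMat v)) (sym (act-idMat _))
Zmat-intertwines s (suc m) v = begin
  act Zmat (act (prefixMat (tCF s) (offset tBlock s (suc m))) v)
    ≡⟨ cong (act Zmat) (act-prefixMat-substitute tBlock s m v) ⟩
  act Zmat (act Pt (act (prefixMat (tCF (drop 1 s)) (offset tBlock (drop 1 s) m)) v))
    ≡⟨ Zmat-intertwines-block (s 0) (drop 1 s) (drop 1 s) _ ⟩
  act Pz (act Zmat (act (prefixMat (tCF (drop 1 s)) (offset tBlock (drop 1 s) m)) v))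
    ≡⟨ cong (act Pz) (Zmat-intertwines (drop 1 s) m v) ⟩
  act Pz (act (prefixMat (zCF (drop 1 s)) (offset zBlock (drop 1 s) m)) (act Zmat v))
    ≡⟨ act-prefixMat-substitute zBlock s m (act Zmat v) ⟨
  act (prefixMat (zCF s) (offset zBlock s (suc m))) (act Zmat v) ∎
  where
  open ≡-Reasoning
  Pt = prefixMat (tCF s) (length (tBlock (s 0)))
  Pz = prefixMat (zCF s) (length (zBlock (s 0)))

twice-push3+Zmat≃1 : ∀ {p q} → 1 ≤ q →
  toℚ (push 3 (p , q)) Q.+ toℚ (push 3 (p , q)) Q.+ toℚ (act Zmat (p , q)) ≃ 1ℚᵘ
twice-push3+Zmat≃1 {p} {q} 1≤q =
  QP.≃-trans (QP.+-congˡ (toℚ (act Zmat (p , q))) (toℚ-+-sameDen 1≤e))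
  (QP.≃-trans (toℚ-+ 1≤e 1≤e′)
  (toℚ-≃ (*-mono-≤ 1≤e 1≤e′) (s≤s z≤n)
    (solve 2 (λ p q → ((q :+ q) :* (con 1 :* p :+ con 3 :* q) :+ (con 1 :* p :+ con 1 :* q) :* (p :+ con 3 :* q)) :* con 1
                     := con 1 :* ((p :+ con 3 :* q) :* (con 1 :* p :+ con 3 :* q))) refl p q)))
  where
  open +-*-Solver
  1≤e : 1 ≤ p + 3 * q
  1≤e = ≤-trans 1≤q (≤-trans (m≤m+n q (2 * q)) (m≤n+m (3 * q) p))
  1≤e′ : 1 ≤ 1 * p + 3 * q
  1≤e′ = subst (λ p′ → 1 ≤ p′ + 3 * q) (sym (*-identityˡ p)) 1≤e

Zmat-unit : ∀ {r} → UnitFrac r → UnitFrac (act Zmat r)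
Zmat-unit {p , q} (_ , 1≤q) =
  +-monoʳ-≤ (1 * p) (*-monoˡ-≤ q (s≤s (z≤n {2}))) , ≤-trans 1≤q (≤-trans (m≤m+n q (2 * q)) (m≤n+m (3 * q) (1 * p)))

sum-error : ∀ s m n → offset tBlock s m ≤ n →
  let D = Mat.d (prefixMat (zCF s) (offset zBlock s m)) in
  ∣ conv (xCF s) (suc n) Q.+ conv (xCF s) (suc n) Q.+ conv (zCF s) (suc n) Q.- 1ℚᵘ ∣ Q.≤ toℚ (1 , D * D)
sum-error s m n L≤n = begin
  ∣ X Q.+ X Q.+ Z Q.- 1ℚᵘ ∣                          ≃⟨ QP.∣-∣-cong error≃ ⟩
  ∣ Z Q.- W ∣                                        ≡⟨ cong₂ (λ z w → ∣ toℚ z Q.- toℚ w ∣) z≡ w≡ ⟩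
  ∣ toℚ (act Pz z′) Q.- toℚ (act Pz (act Zmat u)) ∣  ≤⟨ act-dist Pz (prefixMat-unimodular (zCF s) L) (prefixMat-den-pos (zCF s) L)
                                                           (frac-unit (zCF (drop m s)) (suc n ∸ L))
                                                           (Zmat-unit (frac-unit (tCF (drop m s)) (n ∸ offset tBlock s m))) ⟩
  toℚ (1 , Mat.d Pz * Mat.d Pz)                      ∎
  where
  open QP.≤-Reasoning
  L = offset zBlock s m
  Pz = prefixMat (zCF s) L
  v = frac (tCF s) n
  u = frac (tCF (drop m s)) (n ∸ offset tBlock s m)
  z′ = frac (zCF (drop m s)) (suc n ∸ L)
  X = conv (xCF s) (suc n)
  Z = conv (zCF s) (suc n)
  W = toℚ (act Zmat v)
  z≡ : frac (zCF s) (suc n) ≡ act Pz z′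
  z≡ = frac-substitute zBlock s m (suc n)
         (≤-trans (≤-reflexive (sym (offset-cong (λ { false → refl ; true → refl }) s m))) (m≤n⇒m≤1+n L≤n))
  w≡ : act Zmat v ≡ act Pz (act Zmat u)
  w≡ = trans (cong (act Zmat) (frac-substitute tBlock s m n L≤n)) (Zmat-intertwines s m u)
  X+X+W≃1 : X Q.+ X Q.+ W ≃ 1ℚᵘ
  X+X+W≃1 = subst (λ X′ → X′ Q.+ X′ Q.+ W ≃ 1ℚᵘ) (cong toℚ (sym (frac-suc (xCF s) n)))
              (twice-push3+Zmat≃1 {proj₁ v} (proj₂ (frac-unit (tCF s) n)))
  error≃ : X Q.+ X Q.+ Z Q.- 1ℚᵘ ≃ Z Q.- W
  error≃ = begin-equality
    X Q.+ X Q.+ Z Q.- 1ℚᵘ                   ≃⟨ solve 4 (λ X Z W o → X :+ X :+ Z :- o := (Z :- W) :+ ((X :+ X :+ W) :- o)) QP.≃-refl X Z W 1ℚᵘ ⟩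
    (Z Q.- W) Q.+ ((X Q.+ X Q.+ W) Q.- 1ℚᵘ) ≃⟨ QP.+-congʳ (Z Q.- W) (QP.p≃q⇒p-q≃0 _ _ X+X+W≃1) ⟩
    (Z Q.- W) Q.+ 0ℚᵘ                       ≃⟨ QP.+-identityʳ (Z Q.- W) ⟩
    Z Q.- W                                 ∎
    where open QSolver.+-*-Solver

sum-is-one : ∀ s → SumIsOne (xCF s) (xCF s) (zCF s)
sum-is-one s = converges-if {λ n → conv (xCF s) n Q.+ conv (xCF s) n Q.+ conv (zCF s) n} {1ℚᵘ}
  λ k → suc (offset tBlock s (suc k)) , within k
  where
  within : ∀ k n → suc (offset tBlock s (suc k)) ≤ n →
    ∣ conv (xCF s) n Q.+ conv (xCF s) n Q.+ conv (zCF s) n Q.- 1ℚᵘ ∣ Q.≤ toℚ (1 , suc k)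
  within k (suc n) (s≤s L≤n) = QP.≤-trans (sum-error s (suc k) n L≤n) (toℚ-1/-antimono (s≤s z≤n) (begin
    suc k                      ≤⟨ m≤offset zBlock s (suc k) ⟩
    L                          ≤⟨ prefixMat-den≥ (zCF s) L ⟩
    Mat.d Pz                   ≤⟨ n≤n*n (prefixMat-den-pos (zCF s) L) ⟩
    Mat.d Pz * Mat.d Pz        ∎))
    where
    open ≤-Reasoning
    L = offset zBlock s (suc k)
    Pz = prefixMat (zCF s) L

push-anti : ∀ {a a′ r r′} → a < a′ → UnitFrac r → UnitFrac r′ → toℚ (push (suc a′) r) Q.≤ toℚ (push (suc a) r′)
push-anti {a} {a′} {p , q} {p′ , q′} a<a′ (_ , 1≤q) (p′≤q′ , 1≤q′) =
  toℚ-≤ (push-den-pos a′ {p} 1≤q) (push-den-pos a {p′} 1≤q′) (begin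
    q * (p′ + suc a * q′)   ≤⟨ *-monoʳ-≤ q (+-monoˡ-≤ (suc a * q′) p′≤q′) ⟩
    q * (suc (suc a) * q′)  ≡⟨ solve 3 (λ q q′ a → q :* ((con 2 :+ a) :* q′) := q′ :* ((con 2 :+ a) :* q)) refl q q′ a ⟩
    q′ * (suc (suc a) * q)  ≤⟨ *-monoʳ-≤ q′ (*-monoˡ-≤ q (s≤s a<a′)) ⟩
    q′ * (suc a′ * q)       ≤⟨ *-monoʳ-≤ q′ (m≤n+m (suc a′ * q) p) ⟩
    q′ * (p + suc a′ * q)   ∎)
  where open ≤-Reasoning; open +-*-Solver

x≤z : ∀ s → xCF s ≤ᴿ zCF s
x≤z s = ≤ᴿ-if-pointwise λ where
  zero    → QP.≤-refl
  (suc n) → subst₂ (λ X Z → toℚ X Q.≤ toℚ Z) (sym (frac-suc (xCF s) n))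
              (sym (trans (frac-suc (zCF s) n) (cong (λ a → push (suc a) (frac (drop 1 (zCF s)) n)) (zBlock-head (s 0)))))
              (push-anti {1} {2} (s≤s (s≤s z≤n)) (frac-unit (tCF s) n) (frac-unit (drop 1 (zCF s)) n))

solution-if : ∀ {P : CF → Set} s → P (xCF s) → P (zCF s) → Solution P (xCF s , xCF s , zCF s)
solution-if s Px Pz = Px , Px , Pz , ≤ᴿ-if-pointwise (λ _ → QP.≤-refl) , x≤z s , sum-is-one s

-- Telling solutions apart

tCF-frac-inRange : ∀ s m → InRange (s 0) (frac (tCF s) (2 + m))
tCF-frac-inRange s m = inRange (s 0) (drop 1 s)
  where
  inRange : ∀ b s′ → InRange b (frac (spell tBlock (tBlock b) s′) (2 + m))
  inRange false s′ = subst (InRange false) (sym (frac-suc-suc _ m))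
    (push-push-inRange-false (tCF s′ 0) (tBlock-head≥1 (s′ 0)) (frac-unit (drop 1 (tCF s′)) m))
  inRange true  s′ = subst (InRange true) (sym (frac-suc-suc _ m))
    (push-push-inRange-true (frac-unit (drop 2 (spell tBlock (tBlock true) s′)) m))

headMat : (ℕ → Bool) → ℕ → Mat
headMat s n = prefixMat (xCF s) (suc (offset tBlock s n))

frac-xCF-after-head : ∀ s n m → frac (xCF s) (suc (offset tBlock s n) + m) ≡ act (headMat s n) (frac (tCF (drop n s)) m)
frac-xCF-after-head s n m = trans (frac-+ (xCF s) (suc (offset tBlock s n)) m)
  (cong (act (headMat s n)) (frac-cong m (substitute-drop tBlock s n)))

headMat-agree : ∀ {s s′} n → (∀ j → j < n → s j ≡ s′ j) →
  offset tBlock s n ≡ offset tBlock s′ n × headMat s n ≡ headMat s′ n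
headMat-agree {s} {s′} n agree = proj₁ same ,
  trans (prefixMat-agree {xCF s} {xCF s′} (suc (offset tBlock s n)) λ { zero _ → refl ; (suc k) (s≤s k<L) → proj₂ same k k<L })
        (cong (λ L → prefixMat (xCF s′) (suc L)) (proj₁ same))
  where same = substitute-agree tBlock n agree

headMat-separation : ∀ s n → Separation (headMat s n)
headMat-separation s n = separation (headMat s n) (prefixMat-unimodular (xCF s) L) (prefixMat-den-pos (xCF s) L)
  where L = suc (offset tBlock s n)

-- conv a K lies within δ = 1/K of all later convergents of a (conv-cauchy), which is what choose needs.
chooseBit : (ℕ → Bool) → ℕ → CF → Bool
chooseBit s n a = choose S (conv a (Separation.K S))
  where S = headMat-separation s n

xCF-apart-chosen : ∀ {s s′} n a → (∀ j → j < n → s j ≡ s′ j) → s n ≡ chooseBit s′ n a → ¬ (xCF s ≃ᴿ a)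
xCF-apart-chosen {s} {s′} n a agree chosen = ≄ᴿ-if-apart (0<toℚ-1 1≤K) far
  where
  S = headMat-separation s′ n
  open Separation S
  A = conv a K
  L = suc (offset tBlock s n)
  far : ∀ N₀ → ∃ λ N → N₀ ≤ N × δ Q.≤ ∣ conv (xCF s) N Q.- conv a N ∣
  far N₀ = N , ≤-trans (m≤m+n N₀ K) m≤N , subst (λ v → δ Q.≤ ∣ toℚ v Q.- conv a N ∣) (sym x≡)
    (ε+ε≤∣p-q∣⇒ε≤∣p-r∣ {toℚ (act (headMat s′ n) r)} {A} {conv a N}
      (choose-far S A (frac-unit (tCF (drop n s)) (2 + m)) inRange)
      (conv-cauchy a 1≤K (≤-trans (m≤n+m K N₀) m≤N)))
    where
    m = N₀ + K
    N = L + (2 + m)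
    m≤N = ≤-trans (m≤n+m m 2) (m≤n+m (2 + m) L)
    r = frac (tCF (drop n s)) (2 + m)
    x≡ : frac (xCF s) N ≡ act (headMat s′ n) r
    x≡ = trans (frac-xCF-after-head s n (2 + m)) (cong (λ M → act M r) (proj₂ (headMat-agree n agree)))
    inRange : InRange (choose S A) r
    inRange = subst (λ b → InRange b r) (trans (cong s (+-identityʳ n)) chosen) (tCF-frac-inRange (drop n s) m)

xCF-apart-differ : ∀ {s s′} n → (∀ j → j < n → s j ≡ s′ j) → s′ n ≡ not (s n) → ¬ (xCF s ≃ᴿ xCF s′)
xCF-apart-differ {s} {s′} n agree differ = ≄ᴿ-if-apart (0<toℚ-1 1≤K) far
  where
  S = headMat-separation s n
  open Separation S
  L = suc (offset tBlock s n)
  far : ∀ N₀ → ∃ λ N → N₀ ≤ N × δ Q.≤ ∣ conv (xCF s) N Q.- conv (xCF s′) N ∣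
  far N₀ = N , ≤-trans (m≤n+m N₀ 2) (m≤n+m (2 + N₀) L) ,
    subst₂ (λ v v′ → δ Q.≤ ∣ toℚ v Q.- toℚ v′ ∣) (sym (frac-xCF-after-head s n (2 + N₀))) (sym x′≡)
      (QP.≤-trans (QP.p≤p+q δ δ {{Q.nonNegative (QP.<⇒≤ (0<toℚ-1 1≤K))}})
        (separated S (s n) (frac-unit (tCF (drop n s)) (2 + N₀)) (frac-unit (tCF (drop n s′)) (2 + N₀)) inRange inRange′))
    where
    N = L + (2 + N₀)
    r = frac (tCF (drop n s)) (2 + N₀)
    r′ = frac (tCF (drop n s′)) (2 + N₀)
    x′≡ : frac (xCF s′) N ≡ act (headMat s n) r′
    x′≡ = trans (cong (λ l → frac (xCF s′) (suc l + (2 + N₀))) (proj₁ (headMat-agree n agree)))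
            (trans (frac-xCF-after-head s′ n (2 + N₀)) (cong (λ M → act M r′) (sym (proj₂ (headMat-agree n agree)))))
    inRange : InRange (s n) r
    inRange = subst (λ b → InRange b r) (cong s (+-identityʳ n)) (tCF-frac-inRange (drop n s) N₀)
    inRange′ : InRange (not (s n)) r′
    inRange′ = subst (λ b → InRange b r′) (trans (cong s′ (+-identityʳ n)) differ) (tCF-frac-inRange (drop n s′) N₀)

update : ∀ {A : Set} → (ℕ → A) → ℕ → A → ℕ → A
update s n v j with j ℕ.≟ n
... | yes _ = v
... | no  _ = s j

update-same : ∀ {A : Set} (s : ℕ → A) n v → update s n v n ≡ v
update-same s n v with n ℕ.≟ n
... | yes _   = refl
... | no  n≢n = ⊥-elim (n≢n refl)

update-other : ∀ {A : Set} (s : ℕ → A) n v {j} → j ≢ n → update s n v j ≡ s j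
update-other s n v {j} j≢n with j ℕ.≟ n
... | yes j≡n = ⊥-elim (j≢n j≡n)
... | no  _   = refl

diagonalPrefix : (ℕ → Triple) → ℕ → ℕ → Bool
diagonalPrefix f zero    = λ _ → false
diagonalPrefix f (suc n) = update (diagonalPrefix f n) n (chooseBit (diagonalPrefix f n) n (proj₁ (f n)))

diagonal : (ℕ → Triple) → ℕ → Bool
diagonal f j = diagonalPrefix f (suc j) j

diagonalPrefix-stable : ∀ f n j → j < n → diagonal f j ≡ diagonalPrefix f n j
diagonalPrefix-stable f (suc n) j j<1+n with m<1+n⇒m<n∨m≡n j<1+n
... | inj₂ refl = refl
... | inj₁ j<n  = trans (diagonalPrefix-stable f n j j<n) (sym (update-other _ n _ (<⇒≢ j<n)))

uncountably-many : UncountablyManySolutions (Bad 3)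
uncountably-many f = (xCF s , xCF s , zCF s) ,
  solution-if {Bad 3} s (λ k → s≤s (xCF-≤2 s k)) (λ k → s≤s (zCF-≤2 s k)) ,
  λ n x≃ → xCF-apart-chosen n (proj₁ (f n)) (diagonalPrefix-stable f n) (update-same _ n _) (proj₁ x≃)
  where s = diagonal f

single : ℕ → ℕ → Bool
single m = update (λ _ → false) m true

bad2*-if : ∀ c j → (∀ k → c k ≤ 2) → (∀ k → j ≤ k → c k ≤ 1) → Bad2* c
bad2*-if c j ≤2 ≤1 = j , λ k → (λ _ → s≤s (≤2 k)) , (λ j≤k → s≤s (≤1 k j≤k))

single-after : ∀ m j → suc m ≤ j → single m j ≡ false
single-after m j m<j = update-other _ m true (≢-sym (<⇒≢ m<j))

xCF-single-bad2* : ∀ m → Bad2* (xCF (single m))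
xCF-single-bad2* m = bad2*-if (xCF s) (suc (offset tBlock s (suc m))) (xCF-≤2 s) tail≤1
  where
  s = single m
  tail≤1 : ∀ k → suc (offset tBlock s (suc m)) ≤ k → xCF s k ≤ 1
  tail≤1 (suc k) (s≤s L≤k) = substitute-≤-eventually tBlock s (suc m) (single-after m) (s≤s z≤n ∷ []) k L≤k

zCF-single-bad2* : ∀ m → Bad2* (zCF (single m))
zCF-single-bad2* m = bad2*-if (zCF s) (offset zBlock s (suc m)) (zCF-≤2 s)
  (substitute-≤-eventually zBlock s (suc m) (single-after m) (s≤s z≤n ∷ []))
  where s = single m

single-below : ∀ {m k j} → j < m → j < k → single m j ≡ single k j
single-below j<m j<k = trans (update-other _ _ true (<⇒≢ j<m)) (sym (update-other _ _ true (<⇒≢ j<k)))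

xCF-single-apart : ∀ {m k} → m ≢ k → ¬ (xCF (single m) ≃ᴿ xCF (single k))
xCF-single-apart {m} {k} m≢k with <-cmp m k
... | tri< m<k _ _ = xCF-apart-differ m (λ j j<m → single-below j<m (<-trans j<m m<k))
  (trans (update-other _ k true (<⇒≢ m<k)) (cong not (sym (update-same _ m true))))
... | tri≈ _ m≡k _ = ⊥-elim (m≢k m≡k)
... | tri> _ _ k<m = xCF-apart-differ k (λ j j<k → single-below (<-trans j<k k<m) j<k)
  (trans (update-same _ k true) (cong not (sym (update-other _ m true (<⇒≢ k<m)))))

infinitely-many : InfinitelyManySolutions Bad2*
infinitely-many = (λ m → xCF (single m) , xCF (single m) , zCF (single m)) ,
  (λ m → solution-if {Bad2*} (single m) (xCF-single-bad2* m) (zCF-single-bad2* m)) ,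
  λ m k m≢k x≃ → xCF-single-apart m≢k (proj₁ x≃)

theorem2p10 : InfinitelyManySolutions Bad2* × UncountablyManySolutions (Bad 3)
theorem2p10 = infinitely-many , uncountably-many
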